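{- Let $o,d$ be fixed vertices of $\mathbb{Z}^2$ and let $\mathbb{B}$ be a set of spanning subgraphs of $\mathbb{Z}^2$ which is compact in the product topology. Let $A$ be a (possibly infinite) algorithm that solves the set of mazes $\{(B,o,d): B\in\mathbb{B}\}$. Then there exists a finite initial segment $A_0$ of $A$ that solves this set of mazes.
   Context: Spanning subgraphs of $\mathbb{Z}^2$ (boards) are identified with indicator functions $e(\mathbb{Z}^2)\to\{0,1\}$ of their edge sets, with the product topology. Each edge is traversable in both directions, and the directed edge from $(x,y)$ to $(x,y+1)$, $(x,y-1)$, $(x+1,y)$, $(x-1,y)$ has colour $N$, $S$, $E$, $W$. An algorithm is a finite or infinite sequence of instructions from $\{N,S,E,W\}$. A robot at $v$ executing instruction $I$ moves along the edge of colour $I$ leaving $v$ if present in the board, otherwise stays at $v$. For a maze $(B,o,d)$ the robot starts at $o$ and executes the instructions in order; the algorithm solves the maze if the robot visits $d$ at some time, and solves a set of mazes if it solves each of them. -}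

module Defs where

open import Data.Nat using (ℕ)
open import Data.Integer using (ℤ; _+_; _-_; 1ℤ)
open import Data.Bool using (Bool; true; false)
open import Data.Product using (_×_; _,_; ∃; ∃-syntax)
open import Data.List using (List; []; _∷_; take)
open import Data.List.Membership.Propositional using (_∈_)
open import Data.List.Relation.Unary.Any using (Any)
open import Relation.Binary.PropositionalEquality using (_≡_)

Vertex : Set
Vertex = ℤ × ℤ

-- Undirected edges of ℤ²: an edge is named by its lower/left endpoint and
-- its orientation.  (x , y , horiz) is {(x,y),(x+1,y)};
-- (x , y , vert) is {(x,y),(x,y+1)}.
data Orient : Set where
  horiz vert : Orient

Edge : Set
Edge = ℤ × ℤ × Orient

-- A board (spanning subgraph of ℤ²) = indicator function of its edge set.
Board : Set
Board = Edge → Bool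

data Instr : Set where
  N S E W : Instr

edgeOf : Instr → Vertex → Edge
edgeOf N (x , y) = (x , y , vert)
edgeOf S (x , y) = (x , y - 1ℤ , vert)
edgeOf E (x , y) = (x , y , horiz)
edgeOf W (x , y) = (x - 1ℤ , y , horiz)

target : Instr → Vertex → Vertex
target N (x , y) = (x , y + 1ℤ)
target S (x , y) = (x , y - 1ℤ)
target E (x , y) = (x + 1ℤ , y)
target W (x , y) = (x - 1ℤ , y)

step : Board → Instr → Vertex → Vertex
step B I v with B (edgeOf I v)
... | true  = target I v
... | false = v

run : Board → Vertex → List Instr → Vertex
run B v []       = v
run B v (I ∷ is) = run B (step B I v) is

data Algorithm : Set where
  finite   : List Instr → Algorithm
  infinite : (ℕ → Instr) → Algorithm

takeSeq : ℕ → (ℕ → Instr) → List Instr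
takeSeq ℕ.zero    f = []
takeSeq (ℕ.suc n) f = f 0 ∷ takeSeq n (λ k → f (ℕ.suc k))

-- The initial segment consisting of the first t instructions
-- (the whole algorithm if it has fewer than t instructions).
prefix : Algorithm → ℕ → List Instr
prefix (finite l)   t = take t l
prefix (infinite f) t = takeSeq t f

Solves : Algorithm → Board → Vertex → Vertex → Set
Solves A B o d = ∃[ t ] run B o (prefix A t) ≡ d

SolvesSet : Algorithm → (Board → Set) → Vertex → Vertex → Set
SolvesSet A 𝔹 o d = ∀ B → 𝔹 B → Solves A B o d

-- Product topology on {0,1}^{edges}: U is open iff every point of U has a
-- basic (cylinder) neighbourhood, determined by finitely many edges, inside U.
IsOpen : (Board → Set) → Set
IsOpen U = ∀ B → U B → ∃[ F ] (∀ B' → (∀ e → e ∈ F → B' e ≡ B e) → U B')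

IsCompact : (Board → Set) → Set₁
IsCompact 𝔹 =
  (I : Set) (U : I → Board → Set) →
  (∀ i → IsOpen (U i)) →
  (∀ B → 𝔹 B → ∃[ i ] U i B) →
  ∃[ is ] (∀ B → 𝔹 B → Any (λ i → U i B) is)

-- Whether the robot stands on d after the first t instructions depends only
-- on the finitely many edges it inspects during those t steps, so for each t
-- the set of boards on which it does is open.  These sets cover the compact
-- set of boards, so finitely many times t₁, …, tₙ suffice, and the initial
-- segment of length max tᵢ solves every maze.
module Submission where

open import Defs
open import Data.Nat using (ℕ; zero; suc; _≤_; s≤s)
open import Data.Bool using (true; false)
open import Data.Product using (∃-syntax; _×_; _,_)
open import Data.List using (List; []; _∷_; take)
open import Data.List.Extrema.Nat using (max; xs≤max)
open import Data.List.Membership.Propositional using (_∈_)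
open import Data.List.Relation.Unary.All using (lookupAny)
open import Data.List.Relation.Unary.Any using (here; there)
open import Relation.Binary.PropositionalEquality using (_≡_; refl; cong; trans)

IsOpenCover : {I : Set} → (I → Board → Set) → (Board → Set) → Set
IsOpenCover U 𝔹 = (∀ i → IsOpen (U i)) × (∀ B → 𝔹 B → ∃[ i ] U i B)

IsCompact⇒boundedIndex : ∀ {𝔹} → IsCompact 𝔹 → (U : ℕ → Board → Set) →
  IsOpenCover U 𝔹 → ∃[ k ] (∀ B → 𝔹 B → ∃[ t ] (t ≤ k × U t B))
IsCompact⇒boundedIndex compact U (open-U , cover) with compact ℕ U open-U cover
... | ts , finiteCover = max 0 ts , λ B B∈𝔹 → _ , lookupAny (xs≤max 0 ts) (finiteCover B B∈𝔹)

inspectedEdges : Board → Vertex → List Instr → List Edge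
inspectedEdges B v []       = []
inspectedEdges B v (I ∷ is) = edgeOf I v ∷ inspectedEdges B (step B I v) is

step-cong : ∀ {B B'} I v → B' (edgeOf I v) ≡ B (edgeOf I v) → step B' I v ≡ step B I v
step-cong {B} {B'} I v agree with B' (edgeOf I v) | B (edgeOf I v) | agree
... | true  | .true  | refl = refl
... | false | .false | refl = refl

run-cong : ∀ {B B'} v is → (∀ e → e ∈ inspectedEdges B v is → B' e ≡ B e) →
  run B' v is ≡ run B v is
run-cong v []       agree = refl
run-cong {B} {B'} v (I ∷ is) agree
  rewrite step-cong {B} {B'} I v (agree _ (here refl)) =
  run-cong (step B I v) is (λ e e∈ → agree e (there e∈))

ReachesAt : Algorithm → Vertex → Vertex → ℕ → Board → Set
ReachesAt A o d t B = run B o (prefix A t) ≡ d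

reachesAt-isOpen : ∀ A o d t → IsOpen (ReachesAt A o d t)
reachesAt-isOpen A o d t B reaches =
  inspectedEdges B o (prefix A t) ,
  λ B' agree → trans (run-cong o (prefix A t) agree) reaches

take-take : ∀ {X : Set} {t k} (xs : List X) → t ≤ k → take t (take k xs) ≡ take t xs
take-take {t = zero}  xs       _       = refl
take-take {t = suc t} []       (s≤s _) = refl
take-take {t = suc t} (x ∷ xs) (s≤s p) = cong (x ∷_) (take-take xs p)

take-takeSeq : ∀ {t k} f → t ≤ k → take t (takeSeq k f) ≡ takeSeq t f
take-takeSeq {zero}  f _       = refl
take-takeSeq {suc t} f (s≤s p) = cong (f 0 ∷_) (take-takeSeq (λ n → f (suc n)) p)

take-prefix : ∀ A {t k} → t ≤ k → take t (prefix A k) ≡ prefix A t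
take-prefix (finite is) = take-take is
take-prefix (infinite f) = take-takeSeq f

reachesAt-prefix : ∀ A {o d t k B} → t ≤ k → ReachesAt A o d t B →
  ReachesAt (finite (prefix A k)) o d t B
reachesAt-prefix A {o} {B = B} t≤k reaches =
  trans (cong (run B o) (take-prefix A t≤k)) reaches

mainTheorem7 : (o d : Vertex) (𝔹 : Board → Set) → IsCompact 𝔹 →
    (A : Algorithm) → SolvesSet A 𝔹 o d →
    ∃[ k ] SolvesSet (finite (prefix A k)) 𝔹 o d
mainTheorem7 o d 𝔹 compact A solves
  with IsCompact⇒boundedIndex compact (λ t → ReachesAt A o d t)
         (reachesAt-isOpen A o d , solves)
... | k , bounded = k , λ B B∈𝔹 → reachesEarly (bounded B B∈𝔹)
  where
  reachesEarly : ∀ {B} → ∃[ t ] (t ≤ k × ReachesAt A o d t B) →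
    Solves (finite (prefix A k)) B o d
  reachesEarly (t , t≤k , reaches) = t , reachesAt-prefix A t≤k reaches
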